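{- Let $\mathcal{K}$ be a complete discrete valued field of characteristic zero with residue field $\kappa$ of characteristic $p>0$ and $p$-basis of size $n$. Let $\{u_1,\dots,u_n\}\subseteq\mathcal{O}_{\mathcal{K}}$ be a lift of a $p$-basis of $\kappa$, $\pi$ a uniformizer of $\mathcal{K}$, and $e'_{\mathcal{K}}=e_{\mathcal{K}}p/(p-1)$. Then every $\alpha\in\mathcal{O}_{\mathcal{K}}^\times$ can be written as $$\alpha=\Big(\sum_{j=0}^{\lceil e'_{\mathcal{K}}\rceil}\sum_{\mathbf{s}\in\{0,\dots,p-1\}^n}a_{j,\mathbf{s}}^p\,\mathbf{u}^{\mathbf{s}}\pi^j\Big)\cdot w$$ for some $a_{j,\mathbf{s}}\in\mathcal{O}_{\mathcal{K}}$ and some $w\in U^{\lceil e'_{\mathcal{K}}\rceil+1}_{\mathcal{K}}$, where the sum is a unit of $\mathcal{O}_{\mathcal{K}}$.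
   Context: $\mathbf{u}^{\mathbf{s}}=u_1^{s_1}\cdots u_n^{s_n}$. $e_{\mathcal{K}}$ is the absolute ramification index of $\mathcal{K}$. $U^m_{\mathcal{K}}=1+\pi^m\mathcal{O}_{\mathcal{K}}$ is the $m$-th unit group. $\lceil\cdot\rceil$ is the ceiling function. -}

module Defs where

open import Level using (Level; _⊔_)
open import Data.Nat as ℕ using (ℕ; zero; suc; _∸_; _≤_; NonZero)
open import Data.Nat.DivMod using (_/_)
open import Data.Nat.Primality using (Prime)
open import Data.Fin using (Fin; toℕ)
open import Data.Vec using (Vec; []; _∷_)
open import Data.List using (List; []; _∷_; map; concatMap; allFin)
open import Data.Product using (Σ; ∃; _×_; _,_)
open import Data.Sum using (_⊎_)
open import Relation.Nullary using (¬_)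
open import Algebra.Bundles using (CommutativeRing)

-- ⌈ a / b ⌉ for b ≥ 1
-- (the value for b = 0 is irrelevant junk; it is only used with b = p - 1 ≥ 1)
ceilDiv : (a b : ℕ) → ℕ
ceilDiv a zero    = 0
ceilDiv a (suc b) = (a ℕ.+ b) / suc b

ceilE' : (e p : ℕ) → ℕ
ceilE' e p = ceilDiv (e ℕ.* p) (p ∸ 1)

allExps : (p n : ℕ) → List (Vec (Fin p) n)
allExps p zero    = [] ∷ []
allExps p (suc n) = concatMap (λ i → map (i ∷_) (allExps p n)) (allFin p)

module RingNotions {c ℓ : Level} (R : CommutativeRing c ℓ) where
  open CommutativeRing R

  pow : Carrier → ℕ → Carrier
  pow x zero    = 1#
  pow x (suc k) = x * pow x k

  natR : ℕ → Carrier
  natR zero    = 0#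
  natR (suc k) = 1# + natR k

  sumL : {A : Set} → (A → Carrier) → List A → Carrier
  sumL f []       = 0#
  sumL f (x ∷ xs) = f x + sumL f xs

  sumTo : ℕ → (ℕ → Carrier) → Carrier
  sumTo zero    f = f 0
  sumTo (suc m) f = sumTo m f + f (suc m)

  mono : {n p : ℕ} → Vec Carrier n → Vec (Fin p) n → Carrier
  mono []       []       = 1#
  mono (u ∷ us) (s ∷ ss) = pow u (toℕ s) * mono us ss

  _∣R_ : Carrier → Carrier → Set (c ⊔ ℓ)
  a ∣R b = ∃ λ q → b ≈ a * q

  IsUnit : Carrier → Set (c ⊔ ℓ)
  IsUnit x = ∃ λ y → x * y ≈ 1#

  record IsDVRWithUniformizer (π : Carrier) : Set (c ⊔ ℓ) where
    field
      one≉zero   : ¬ (1# ≈ 0#)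
      noZeroDiv  : ∀ x y → x * y ≈ 0# → x ≈ 0# ⊎ y ≈ 0#
      π≉0        : ¬ (π ≈ 0#)
      π-nonunit  : ¬ IsUnit π
      factor     : ∀ x → ¬ (x ≈ 0#) → ∃ λ k → ∃ λ u → IsUnit u × x ≈ u * pow π k

  IsPiAdicallyComplete : Carrier → Set (c ⊔ ℓ)
  IsPiAdicallyComplete π =
    (x : ℕ → Carrier) →
    (∀ m → ∃ λ N → ∀ i j → N ≤ i → N ≤ j → pow π m ∣R (x i - x j)) →
    ∃ λ L → ∀ m → ∃ λ N → ∀ i → N ≤ i → pow π m ∣R (x i - L)

  -- characteristic zero (of O_K, equivalently of K = Frac O_K)
  CharZero : Set ℓ
  CharZero = ∀ k → ¬ (natR (suc k) ≈ 0#)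

  -- ũ = (u_1,…,u_n) ⊆ O lifts a p-basis of κ = O/πO: the monomials ū^s, s ∈ {0,…,p-1}^n,
  -- form a basis of κ over κ^p (coefficients in κ^p written as b̄^p)
  module _ (π : Carrier) (p : ℕ) {n : ℕ} (u : Vec Carrier n) where
    pComb : (Vec (Fin p) n → Carrier) → Carrier
    pComb b = sumL (λ s → pow (b s) p * mono u s) (allExps p n)

    record IsLiftOfPBasis : Set (c ⊔ ℓ) where
      field
        spans       : ∀ x → ∃ λ (b : Vec (Fin p) n → Carrier) → π ∣R (x - pComb b)
        independent : ∀ (b : Vec (Fin p) n → Carrier) → π ∣R pComb b → ∀ s → π ∣R b s

  InU : Carrier → ℕ → Carrier → Set (c ⊔ ℓ)
  InU π m w = pow π m ∣R (w - 1#)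

-- Peeling off one p-basis digit at a time, α = Σ_{j ≤ m} (Σ_s a_{j,s}^p u^s) π^j + π^(m+1) r
-- for every m.  The partial sum S is congruent to the unit α modulo π, and in a DVR an element
-- that is a unit modulo π is a unit; so w = S⁻¹ α lies in 1 + π^(m+1) O.  Neither completeness
-- nor the value m = ⌈e'⌉ is needed.
module Submission where

open import Defs
open import Level using (Level)
open import Data.Nat using (ℕ; zero; suc)
open import Data.Nat.Primality using (Prime)
open import Data.Fin using (Fin)
open import Data.Vec using (Vec)
open import Data.Product using (∃; _×_; _,_; proj₁; proj₂)
open import Data.Empty using (⊥-elim)
open import Relation.Nullary using (¬_)
open import Algebra.Bundles using (CommutativeRing)
import Algebra.Properties.Group as GroupProperties
import Relation.Binary.Reasoning.Setoid as SetoidReasoning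

module _ {c ℓ : Level} (O : CommutativeRing c ℓ) where
  open CommutativeRing O
  open RingNotions O
  open GroupProperties +-group using (//-rightDividesˡ; //-rightDividesʳ)
  open SetoidReasoning setoid

  x-y≈z⇒x≈y+z : ∀ {x y z} → x - y ≈ z → x ≈ y + z
  x-y≈z⇒x≈y+z {x} {y} {z} x-y≈z = begin
    x           ≈⟨ //-rightDividesˡ y x ⟨
    (x - y) + y ≈⟨ +-congʳ x-y≈z ⟩
    z + y       ≈⟨ +-comm z y ⟩
    y + z       ∎

  x≈y+z⇒x-y≈z : ∀ {x y z} → x ≈ y + z → x - y ≈ z
  x≈y+z⇒x-y≈z {x} {y} {z} x≈y+z = begin
    x - y       ≈⟨ +-congʳ (trans x≈y+z (+-comm y z)) ⟩
    (z + y) - y ≈⟨ //-rightDividesʳ y z ⟩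
    z           ∎

  *-exchange : ∀ x y z → x * (y * z) ≈ y * (x * z)
  *-exchange x y z = begin
    x * (y * z) ≈⟨ *-assoc x y z ⟨
    (x * y) * z ≈⟨ *-congʳ (*-comm x y) ⟩
    (y * x) * z ≈⟨ *-assoc y x z ⟩
    y * (x * z) ∎

  isUnit-resp-≈ : ∀ {x y} → x ≈ y → IsUnit x → IsUnit y
  isUnit-resp-≈ x≈y (z , xz≈1) = z , trans (*-congʳ (sym x≈y)) xz≈1

  module _ {α S I q r : Carrier} (S*I≈1 : S * I ≈ 1#) (α≈S+qr : α ≈ S + q * r) where

    α≈S*[I*α] : α ≈ S * (I * α)
    α≈S*[I*α] = sym (begin
      S * (I * α) ≈⟨ *-assoc S I α ⟨
      (S * I) * α ≈⟨ *-congʳ S*I≈1 ⟩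
      1# * α      ≈⟨ *-identityˡ α ⟩
      α           ∎)

    I*α-1≈q*[I*r] : I * α - 1# ≈ q * (I * r)
    I*α-1≈q*[I*r] = x≈y+z⇒x-y≈z (begin
      I * α               ≈⟨ *-congˡ α≈S+qr ⟩
      I * (S + q * r)     ≈⟨ distribˡ I S (q * r) ⟩
      I * S + I * (q * r) ≈⟨ +-cong (*-comm I S) (*-exchange I q r) ⟩
      S * I + q * (I * r) ≈⟨ +-congʳ S*I≈1 ⟩
      1# + q * (I * r)    ∎)

  module _ {π : Carrier} (dvr : IsDVRWithUniformizer π) where
    open IsDVRWithUniformizer dvr

    ¬isUnit-π* : ∀ z → ¬ IsUnit (π * z)
    ¬isUnit-π* z (y , πz*y≈1) = π-nonunit (z * y , trans (sym (*-assoc π z y)) πz*y≈1)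

    isUnit[x+π*t]⇒¬π∣x : ∀ x t → IsUnit (x + π * t) → ¬ π ∣R x
    isUnit[x+π*t]⇒¬π∣x x t x+πt-unit (z , x≈πz) =
      ¬isUnit-π* (z + t) (isUnit-resp-≈ (trans (+-congʳ x≈πz) (sym (distribˡ π z t))) x+πt-unit)

    -- x ≠ 0 is u π^k; π ∤ x forces k = 0.
    isUnit[x+π*t]⇒isUnit[x] : ∀ x t → IsUnit (x + π * t) → IsUnit x
    isUnit[x+π*t]⇒isUnit[x] x t x+πt-unit with factor x x≉0
      where
      x≉0 : ¬ x ≈ 0#
      x≉0 x≈0 = isUnit[x+π*t]⇒¬π∣x x t x+πt-unit (0# , trans x≈0 (sym (zeroʳ π)))
    ... | zero  , v , (v⁻¹ , v*v⁻¹≈1) , x≈v*1 =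
      v⁻¹ , trans (*-congʳ (trans x≈v*1 (*-identityʳ v))) v*v⁻¹≈1
    ... | suc k , v , _ , x≈v*ππᵏ =
      ⊥-elim (isUnit[x+π*t]⇒¬π∣x x t x+πt-unit (v * pow π k , trans x≈v*ππᵏ (*-exchange v π (pow π k))))

  module PAdicDigits {π : Carrier} {p n : ℕ} {u : Vec Carrier n}
    (spans : ∀ x → ∃ λ (b : Vec (Fin p) n → Carrier) → π ∣R (x - pComb π p u b)) where

    digit : Carrier → Vec (Fin p) n → Carrier
    digit x = proj₁ (spans x)

    carry : Carrier → Carrier
    carry x = proj₁ (proj₂ (spans x))

    x≈digit+π*carry : ∀ x → x ≈ pComb π p u (digit x) + π * carry x
    x≈digit+π*carry x = x-y≈z⇒x≈y+z (proj₂ (proj₂ (spans x)))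

    remainder : Carrier → ℕ → Carrier
    remainder x zero    = x
    remainder x (suc j) = carry (remainder x j)

    digits : Carrier → ℕ → Vec (Fin p) n → Carrier
    digits x j = digit (remainder x j)

    partialSum : Carrier → ℕ → Carrier
    partialSum x m = sumTo m (λ j → pComb π p u (digits x j) * pow π j)

    x≈partialSum+πᵐ⁺¹*remainder : ∀ x m →
      x ≈ partialSum x m + pow π (suc m) * remainder x (suc m)
    x≈partialSum+πᵐ⁺¹*remainder x zero = begin
      x                              ≈⟨ x≈digit+π*carry x ⟩
      pComb π p u (digits x 0) + π * remainder x 1
        ≈⟨ +-cong (*-identityʳ _) (*-congʳ (*-identityʳ π)) ⟨
      partialSum x 0 + pow π 1 * remainder x 1 ∎
    x≈partialSum+πᵐ⁺¹*remainder x (suc m) = begin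
      x                                  ≈⟨ x≈partialSum+πᵐ⁺¹*remainder x m ⟩
      S + πᵐ⁺¹ * r                       ≈⟨ +-congˡ (*-congˡ (x≈digit+π*carry r)) ⟩
      S + πᵐ⁺¹ * (D + π * r′)            ≈⟨ +-congˡ (distribˡ πᵐ⁺¹ D (π * r′)) ⟩
      S + (πᵐ⁺¹ * D + πᵐ⁺¹ * (π * r′))   ≈⟨ +-assoc S _ _ ⟨
      (S + πᵐ⁺¹ * D) + πᵐ⁺¹ * (π * r′)
        ≈⟨ +-cong (+-congˡ (*-comm πᵐ⁺¹ D)) (trans (*-exchange πᵐ⁺¹ π r′) (sym (*-assoc π πᵐ⁺¹ r′))) ⟩
      partialSum x (suc m) + pow π (suc (suc m)) * r′ ∎
      where
      S πᵐ⁺¹ r r′ D : Carrier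
      S    = partialSum x m
      πᵐ⁺¹ = pow π (suc m)
      r    = remainder x (suc m)
      r′   = remainder x (suc (suc m))
      D    = pComb π p u (digits x (suc m))

lemma6p5 : {c ℓ : Level} (O : CommutativeRing c ℓ) →
    let open CommutativeRing O
        open RingNotions O
    in (π : Carrier) → IsDVRWithUniformizer π → IsPiAdicallyComplete π → CharZero →
       (p : ℕ) → Prime p → π ∣R natR p →
       (e : ℕ) → (∃ λ v → IsUnit v × natR p ≈ v * pow π e) →
       (n : ℕ) (u : Vec Carrier n) → IsLiftOfPBasis π p u →
       (α : Carrier) → IsUnit α →
       ∃ λ (a : ℕ → Vec (Fin p) n → Carrier) → ∃ λ (w : Carrier) →
         InU π (suc (ceilE' e p)) w
         × IsUnit (sumTo (ceilE' e p) (λ j → pComb π p u (a j) * pow π j))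
         × α ≈ sumTo (ceilE' e p) (λ j → pComb π p u (a j) * pow π j) * w
lemma6p5 O π dvr _ _ p _ _ e _ n u lift α α-unit =
  digits α , I * α
  , (I * r , I*α-1≈q*[I*r] O S*I≈1 α≈S+qr)
  , (I , S*I≈1)
  , α≈S*[I*α] O S*I≈1 α≈S+qr
  where
  open CommutativeRing O
  open RingNotions O
  open PAdicDigits O {u = u} (IsLiftOfPBasis.spans lift)
  m : ℕ
  m = ceilE' e p
  S r : Carrier
  S = partialSum α m
  r = remainder α (suc m)
  α≈S+qr : α ≈ S + pow π (suc m) * r
  α≈S+qr = x≈partialSum+πᵐ⁺¹*remainder α m
  S-unit : IsUnit S
  S-unit = isUnit[x+π*t]⇒isUnit[x] O dvr S (pow π m * r)
             (isUnit-resp-≈ O (trans α≈S+qr (+-congˡ (*-assoc π (pow π m) r))) α-unit)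
  I : Carrier
  I = proj₁ S-unit
  S*I≈1 : S * I ≈ 1#
  S*I≈1 = proj₂ S-unit
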